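{- For every balanced word $X$, the reduction algorithm applied to $X$ terminates. Here the reduction algorithm produces a sequence $X_0=X, X_1, X_2,\dots$: if $X_i$ is reduced, the algorithm stops and outputs $X_i$; otherwise one takes the leftmost occurrence of a subword of the form $UD$ with $U$ an upper prime and $D$ a lower prime, writes $X_i=W_1UDW_2$, and sets $X_{i+1}=W_1DUW_2$.
   Context: Words are finite products of the letters $L$ and $R$ (possibly empty). A word is balanced if $L$ and $R$ occur in it equally many times. A word is prime if it is nonempty, balanced, and not a product of two nonempty balanced words. For a word $W=a_1\cdots a_n$ and $0\le k\le n$, $e_k(W)=\sum_{i=1}^k\overline{a_i}$ with $\overline{R}=1$, $\overline{L}=-1$. A prime $P$ of length $l(P)$ is an upper prime if $e_k(P)>0$ for $1\le k\le l(P)-1$, and a lower prime if $e_k(P)<0$ for $1\le k\le l(P)-1$. A word is reduced if it contains no subword (consecutive block of letters) of the form $UD$ with $U$ an upper prime and $D$ a lower prime. -}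

module Defs where

open import Data.Nat using (ℕ; _≤_; _<_; _≡ᵇ_)
open import Data.Integer as ℤ using (ℤ; +_; 0ℤ)
open import Data.List using (List; []; _∷_; _++_; length; take)
open import Data.Product using (Σ; ∃; _×_; _,_)
open import Relation.Nullary using (¬_)
open import Relation.Binary.PropositionalEquality using (_≡_)

data Letter : Set where
  L R : Letter

Word : Set
Word = List Letter

countL : Word → ℕ
countL []       = 0
countL (L ∷ w)  = Data.Nat.suc (countL w)
countL (R ∷ w)  = countL w

countR : Word → ℕ
countR []       = 0
countR (L ∷ w)  = countR w
countR (R ∷ w)  = Data.Nat.suc (countR w)

Balanced : Word → Set
Balanced w = countL w ≡ countR w

NonEmpty : Word → Set
NonEmpty w = ¬ (w ≡ [])

val : Letter → ℤ
val R = + 1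
val L = ℤ.- (+ 1)

height : Word → ℤ
height []      = 0ℤ
height (a ∷ w) = val a ℤ.+ height w

e : ℕ → Word → ℤ
e k w = height (take k w)

Prime : Word → Set
Prime w = NonEmpty w × Balanced w ×
          ¬ (Σ Word λ A → Σ Word λ B →
               NonEmpty A × Balanced A × NonEmpty B × Balanced B × w ≡ A ++ B)

UpperPrime : Word → Set
UpperPrime P = Prime P × (∀ k → 1 ≤ k → k < length P → 0ℤ ℤ.< e k P)

LowerPrime : Word → Set
LowerPrime P = Prime P × (∀ k → 1 ≤ k → k < length P → e k P ℤ.< 0ℤ)

Occurrence : Word → Word → Word → Word → Word → Set
Occurrence X W₁ U D W₂ = UpperPrime U × LowerPrime D × X ≡ W₁ ++ (U ++ (D ++ W₂))

Reduced : Word → Set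
Reduced X = ¬ (Σ Word λ W₁ → Σ Word λ U → Σ Word λ D → Σ Word λ W₂ → Occurrence X W₁ U D W₂)

Step : Word → Word → Set
Step X Y = Σ Word λ W₁ → Σ Word λ U → Σ Word λ D → Σ Word λ W₂ →
  Occurrence X W₁ U D W₂ ×
  (∀ V₁ U′ D′ V₂ → Occurrence X V₁ U′ D′ V₂ → length W₁ ≤ length V₁) ×
  Y ≡ W₁ ++ (D ++ (U ++ W₂))

-- The algorithm terminates on X: either X is reduced (stop), or X is not
-- reduced and the algorithm terminates on every possible next word.
-- (Inductive, hence every run from X is finite.)
data Terminates : Word → Set where
  stop : ∀ {X} → Reduced X → Terminates X
  next : ∀ {X} → ¬ Reduced X → (∀ Y → Step X Y → Terminates Y) → Terminates X

-- An upper prime begins with R and a lower prime with L. Hence a step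
-- W₁ U D W₂ ↦ W₁ D U W₂ keeps the length and the prefix W₁ and turns the next
-- letter from R into L: read as a binary numeral (R = 1, L = 0) the word
-- strictly decreases, so every run is finite. Being reduced is decidable, as
-- it quantifies only over the finitely many factorisations of a word; this is
-- what lets a run choose constructively between stopping and stepping.
module Submission where

open import Defs
open import Data.Nat as ℕ using (ℕ; _+_; _^_; _<_; _≤?_; z≤n; s≤s; allUpTo?)
import Data.Nat.Properties as ℕ
open import Data.Nat.Induction using (<-wellFounded)
open import Data.Integer as ℤ using (0ℤ)
import Data.Integer.Properties as ℤ
open import Data.List using (List; []; _∷_; _++_; length)
open import Data.List.Properties using (length-++)
open import Data.Product using (Σ; ∃; ∃₂; _×_; _,_)
open import Data.Sum using (_⊎_; inj₁; inj₂)
open import Data.Empty using (⊥-elim)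
open import Relation.Nullary using (Dec; yes; no; ¬?; map′)
open import Relation.Nullary.Decidable using (_×-dec_; _⊎-dec_; _→-dec_)
open import Relation.Binary.PropositionalEquality
  using (_≡_; refl; cong; sym; module ≡-Reasoning)
open import Induction.WellFounded using (Acc; acc)
open import Algebra.Properties.CommutativeSemigroup ℕ.+-commutativeSemigroup using (x∙yz≈y∙xz)

Splits : {A : Set} → (List A → List A → Set) → List A → Set
Splits P zs = ∃₂ λ xs ys → P xs ys × zs ≡ xs ++ ys

splits? : {A : Set} {P : List A → List A → Set} →
          (∀ xs ys → Dec (P xs ys)) → ∀ zs → Dec (Splits P zs)
splits? {P = P} P? [] = map′ (λ p → [] , [] , p , refl) from (P? [] [])
  where
  from : Splits P [] → P [] []
  from ([] , [] , p , refl) = p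
splits? {P = P} P? (z ∷ zs) =
  map′ to from (P? [] (z ∷ zs) ⊎-dec splits? (λ xs → P? (z ∷ xs)) zs)
  where
  to : P [] (z ∷ zs) ⊎ Splits (λ xs → P (z ∷ xs)) zs → Splits P (z ∷ zs)
  to (inj₁ p)                    = [] , z ∷ zs , p , refl
  to (inj₂ (xs , ys , p , refl)) = z ∷ xs , ys , p , refl
  from : Splits P (z ∷ zs) → P [] (z ∷ zs) ⊎ Splits (λ xs → P (z ∷ xs)) zs
  from ([] , _ , p , refl)      = inj₁ p
  from (_ ∷ xs , ys , p , refl) = inj₂ (xs , ys , p , refl)

between? : {Q : ℕ → Set} → (∀ k → Dec (Q k)) → ∀ n → Dec (∀ k → 1 ℕ.≤ k → k < n → Q k)
between? Q? n = map′ (λ f k 1≤k k<n → f k<n 1≤k) (λ f {k} k<n 1≤k → f k 1≤k k<n)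
  (allUpTo? (λ k → 1 ≤? k →-dec Q? k) n)

nonEmpty? : ∀ w → Dec (NonEmpty w)
nonEmpty? []      = no λ w≢[] → w≢[] refl
nonEmpty? (_ ∷ _) = yes λ ()

balanced? : ∀ w → Dec (Balanced w)
balanced? w = countL w ℕ.≟ countR w

Decomposable : Word → Set
Decomposable w = Σ Word λ A → Σ Word λ B →
  NonEmpty A × Balanced A × NonEmpty B × Balanced B × w ≡ A ++ B

decomposable? : ∀ w → Dec (Decomposable w)
decomposable? w = map′ to from (splits? factors? w)
  where
  Factors : Word → Word → Set
  Factors A B = NonEmpty A × Balanced A × NonEmpty B × Balanced B
  factors? : ∀ A B → Dec (Factors A B)
  factors? A B = nonEmpty? A ×-dec balanced? A ×-dec nonEmpty? B ×-dec balanced? B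
  to : Splits Factors w → Decomposable w
  to (A , B , (a , b , c , d) , eq) = A , B , a , b , c , d , eq
  from : Decomposable w → Splits Factors w
  from (A , B , a , b , c , d , eq) = A , B , (a , b , c , d) , eq

prime? : ∀ w → Dec (Prime w)
prime? w = nonEmpty? w ×-dec balanced? w ×-dec ¬? (decomposable? w)

upperPrime? : ∀ w → Dec (UpperPrime w)
upperPrime? w = prime? w ×-dec between? (λ k → 0ℤ ℤ.<? e k w) (length w)

lowerPrime? : ∀ w → Dec (LowerPrime w)
lowerPrime? w = prime? w ×-dec between? (λ k → e k w ℤ.<? 0ℤ) (length w)

HasOccurrence : Word → Set
HasOccurrence X =
  Σ Word λ W₁ → Σ Word λ U → Σ Word λ D → Σ Word λ W₂ → Occurrence X W₁ U D W₂

hasOccurrence? : ∀ X → Dec (HasOccurrence X)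
hasOccurrence? X = map′ to from (splits? (λ _ → splits? ud?) X)
  where
  UpperThenLower : Word → Word → Set
  UpperThenLower _ = Splits (λ U Z → UpperPrime U × Splits (λ D _ → LowerPrime D) Z)
  ud? : ∀ U Z → Dec (UpperPrime U × Splits (λ D _ → LowerPrime D) Z)
  ud? U Z = upperPrime? U ×-dec splits? (λ D _ → lowerPrime? D) Z
  to : Splits UpperThenLower X → HasOccurrence X
  to (W₁ , _ , (U , _ , (u , D , W₂ , d , refl) , refl) , refl) =
    W₁ , U , D , W₂ , u , d , refl
  from : HasOccurrence X → Splits UpperThenLower X
  from (W₁ , U , D , W₂ , u , d , refl) =
    W₁ , _ , (U , _ , (u , D , W₂ , d , refl) , refl) , refl

reduced? : ∀ X → Dec (Reduced X)
reduced? X = ¬? (hasOccurrence? X)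

upperPrime-head : ∀ {U} → UpperPrime U → ∃ λ u → U ≡ R ∷ u
upperPrime-head {[]}        ((U≢[] , _) , _) = ⊥-elim (U≢[] refl)
upperPrime-head {R ∷ u}     _                = u , refl
upperPrime-head {L ∷ []}    ((_ , () , _) , _)
upperPrime-head {L ∷ _ ∷ _} (_ , e>0) with e>0 1 (s≤s z≤n) (s≤s (s≤s z≤n))
... | ()

lowerPrime-head : ∀ {D} → LowerPrime D → ∃ λ d → D ≡ L ∷ d
lowerPrime-head {[]}        ((D≢[] , _) , _) = ⊥-elim (D≢[] refl)
lowerPrime-head {L ∷ d}     _                = d , refl
lowerPrime-head {R ∷ []}    ((_ , () , _) , _)
lowerPrime-head {R ∷ _ ∷ _} (_ , e<0) with e<0 1 (s≤s z≤n) (s≤s (s≤s z≤n))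
... | ℤ.+<+ ()

value : Word → ℕ
value []      = 0
value (L ∷ w) = value w
value (R ∷ w) = 2 ^ length w + value w

value<2^length : ∀ w → value w < 2 ^ length w
value<2^length []      = s≤s z≤n
value<2^length (L ∷ w) = ℕ.<-≤-trans (value<2^length w) (ℕ.m≤m+n (2 ^ length w) _)
value<2^length (R ∷ w) =
  ℕ.+-monoʳ-< (2 ^ length w) (ℕ.<-≤-trans (value<2^length w) (ℕ.m≤m+n _ 0))

value-L<R : ∀ s t → length s ≡ length t → value (L ∷ s) < value (R ∷ t)
value-L<R s _ eq =
  ℕ.<-≤-trans (value<2^length s) (ℕ.≤-trans (ℕ.≤-reflexive (cong (2 ^_) eq)) (ℕ.m≤m+n _ _))

value-++-monoʳ-< : ∀ W {s t} → length s ≡ length t →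
                   value s < value t → value (W ++ s) < value (W ++ t)
value-++-monoʳ-< []      _  s<t = s<t
value-++-monoʳ-< (L ∷ W) eq s<t = value-++-monoʳ-< W eq s<t
value-++-monoʳ-< (R ∷ W) {s} {t} eq s<t rewrite length-++ W {s} | eq | sym (length-++ W {t}) =
  ℕ.+-monoʳ-< (2 ^ length (W ++ t)) (value-++-monoʳ-< W eq s<t)

length-++-swap : ∀ (A B C : Word) → length (A ++ B ++ C) ≡ length (B ++ A ++ C)
length-++-swap A B C = begin
  length (A ++ B ++ C)            ≡⟨ length-++ A ⟩
  length A + length (B ++ C)      ≡⟨ cong (length A +_) (length-++ B) ⟩
  length A + (length B + length C) ≡⟨ x∙yz≈y∙xz (length A) (length B) (length C) ⟩
  length B + (length A + length C) ≡⟨ cong (length B +_) (length-++ A) ⟨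
  length B + length (A ++ C)      ≡⟨ length-++ B ⟨
  length (B ++ A ++ C)            ∎
  where open ≡-Reasoning

value-swap-< : ∀ W₁ u d W₂ →
  value (W₁ ++ (L ∷ d) ++ (R ∷ u) ++ W₂) < value (W₁ ++ (R ∷ u) ++ (L ∷ d) ++ W₂)
value-swap-< W₁ u d W₂ = value-++-monoʳ-< W₁ same-length
  (value-L<R (d ++ (R ∷ u) ++ W₂) (u ++ (L ∷ d) ++ W₂) (ℕ.suc-injective same-length))
  where
  same-length : length ((L ∷ d) ++ (R ∷ u) ++ W₂) ≡ length ((R ∷ u) ++ (L ∷ d) ++ W₂)
  same-length = length-++-swap (L ∷ d) (R ∷ u) W₂

step-decreases-value : ∀ {X Y} → Step X Y → value Y < value X
step-decreases-value (W₁ , U , D , W₂ , (U-up , D-low , refl) , _ , refl)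
  with upperPrime-head U-up | lowerPrime-head D-low
... | u , refl | d , refl = value-swap-< W₁ u d W₂

terminates : ∀ X → Acc _<_ (value X) → Terminates X
terminates X (acc rec) with reduced? X
... | yes X-reduced    = stop X-reduced
... | no X-not-reduced = next X-not-reduced λ Y step →
  terminates Y (rec (step-decreases-value step))

-- Termination holds for every word.
proposition6p7 : (X : Word) → Balanced X → Terminates X
proposition6p7 X _ = terminates X (<-wellFounded (value X))
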